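{- Let $q\ge 2$ and $d\ge 2$ be integers and put $\kappa=(q^d-1)/(q-1)$. Suppose there is a symmetric $2$-$(m,\kappa,\lambda)$ design whose $(m\times m)$ incidence matrix $A$ is symmetric. Let $L=(e(i,j))$ be a symmetric $(m\times m)$ integer matrix obtained from $A$ by replacing, in each row, the $\kappa$ nonzero entries by the integers $1,2,\dots,\kappa$ bijectively (so $e(i,j)=0$ iff $A_{ij}=0$, and for each $i$ the map $j\mapsto e(i,j)$ is a bijection from $\{j: A_{ij}\neq 0\}$ onto $[\kappa]$). Let $\mathcal{D}_1,\dots,\mathcal{D}_m$ be (not necessarily isomorphic) affine designs with parameters $(q,q^{d-2})$, $\mathcal{D}_i=(\mathcal{P}_i,\mathcal{B}_i)$, with pairwise disjoint point sets, each having $\kappa$ parallel classes, enumerated by $[\kappa]$; denote the $j$-th parallel class of $\mathcal{D}_i$ by $\mathcal{B}_i^j$, and for $x\in\mathcal{P}_i$ denote by $B_i^j(x)$ the block of $\mathcal{B}_i^j$ containing $x$. For each pair $(i,j)$ with $e(i,j)\neq 0$ choose a bijection $\sigma_{i,j}:\mathcal{B}_i^{e(i,j)}\to\mathcal{B}_j^{e(j,i)}$ with $\sigma_{i,j}=\sigma_{j,i}^{ -1}$ for $i\ne j$ and $\sigma_{i,i}$ the identity on $\mathcal{B}_i^{e(i,i)}$. Let $\Gamma$ be the graph with vertex set $\bigcup_{i=1}^m\mathcal{P}_i$ in which two different vertices $x\in\mathcal{P}_i$, $y\in\mathcal{P}_j$ are adjacent iff $e(i,j)\neq 0$ and $y\notin\sigma_{i,j}(B_i^{e(i,j)}(x))$.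 Let $M$ be the adjacency matrix of $\Gamma$, partitioned into $(q^d\times q^d)$ blocks $M_{ij}$ (rows indexed by $\mathcal{P}_i$, columns by $\mathcal{P}_j$). Assume all diagonal blocks $M_{ii}$ are nonzero matrices. Let $PC(M)$ be the matrix obtained from $M$ by replacing every zero off-diagonal block $M_{ij}$ ($i\neq j$) by the all-ones matrix of the same size, and let $PC(\Gamma)$ be the graph with adjacency matrix $PC(M)$. Then $PC(\Gamma)$ is a divisible design graph with parameters $$v=q^d m,\quad k=q^{d-1}(q^d-1)+q^d(m-\kappa),\quad \lambda_1=q^{d-1}(q^d-q^{d-1}-1)+q^d(m-\kappa),$$ $$\lambda_2=q^{d-2}(q-1)^2\lambda+2(q^d-q^{d-1})(\kappa-\lambda)+q^d(m-2\kappa+\lambda),\quad m,\quad n=q^d.$$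
   Context: A $k$-regular graph on $v$ vertices is a divisible design graph with parameters $(v,k,\lambda_1,\lambda_2,m,n)$ if its vertex set can be partitioned into $m$ classes of size $n$ such that any two different vertices in the same class have exactly $\lambda_1$ common neighbours and any two vertices in different classes have exactly $\lambda_2$ common neighbours. A symmetric $2$-$(m,\kappa,\lambda)$ design has $m$ points and $m$ blocks, each block of size $\kappa$, any two distinct points lying in exactly $\lambda$ common blocks. An affine design with parameters $(q,r)$ is a $2$-design in which any two blocks are either disjoint or meet in exactly $r$ points, and each block together with all blocks disjoint from it forms a parallel class: a set of $q$ mutually disjoint blocks partitioning the point set. An affine design with parameters $(q,q^{d-2})$ has $q^d$ points, blocks of size $q^{d-1}$, $(q^d-1)/(q-1)$ parallel classes, and any two distinct points lie in exactly $(q^{d-1}-1)/(q-1)$ common blocks. -}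

module Defs where

open import Data.Nat using (ℕ; zero; suc; _+_; _*_; _∸_; _^_; _≤_; _≡ᵇ_)
open import Data.Nat.Properties using () renaming (_≟_ to _≟ℕ_)
open import Data.Bool using (Bool; true; false; _∧_; _∨_; not; if_then_else_)
open import Data.Fin using (Fin; _≟_)
open import Data.List using (List; []; _∷_; map; concatMap; length; foldr)
open import Data.Bool.ListAction using (any)
open import Data.List.Base using (allFin)
open import Data.Product using (Σ; ∃; _×_; _,_; proj₁; proj₂)
open import Data.Sum using (_⊎_)
open import Relation.Nullary using (¬_; yes; no)
open import Relation.Nullary.Decidable using (⌊_⌋)
open import Relation.Binary.PropositionalEquality using (_≡_; _≢_; refl)

countB : {A : Set} → (A → Bool) → List A → ℕ
countB p [] = 0
countB p (x ∷ xs) = if p x then suc (countB p xs) else countB p xs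

#_ : {n : ℕ} → (Fin n → Bool) → ℕ
#_ {n} p = countB p (allFin n)

anyFin : {n : ℕ} → (Fin n → Bool) → Bool
anyFin {n} p = any p (allFin n)

record IsSymDesign (m κ lam : ℕ) (A : Fin m → Fin m → Bool) : Set where
  field
    blockSize : ∀ (b : Fin m) → # (λ p → A p b) ≡ κ
    balanced  : ∀ (p p' : Fin m) → p ≢ p' → # (λ b → A p b ∧ A p' b) ≡ lam

record IsLabelling (m κ : ℕ) (A : Fin m → Fin m → Bool) (e : Fin m → Fin m → ℕ) : Set where
  field
    zero-off  : ∀ i j → A i j ≡ false → e i j ≡ 0
    range     : ∀ i j → A i j ≡ true → 1 ≤ e i j × e i j ≤ κ
    injective : ∀ i j j' → A i j ≡ true → A i j' ≡ true → e i j ≡ e i j' → j ≡ j'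
    surjective : ∀ i c → 1 ≤ c → c ≤ κ → Σ (Fin m) λ j → A i j ≡ true × e i j ≡ c

record AffineDesign (q r : ℕ) : Set where
  field
    nP nB : ℕ
    I : Fin nP → Fin nB → Bool
  meet : Fin nB → Fin nB → ℕ
  meet B B' = # (λ x → I x B ∧ I x B')
  -- B' belongs to the parallel class of B
  inClass : Fin nB → Fin nB → Bool
  inClass B B' = ⌊ B ≟ B' ⌋ ∨ (meet B B' ≡ᵇ 0)
  field
    k λA : ℕ
    uniform  : ∀ B → # (λ x → I x B) ≡ k
    balanced : ∀ x y → x ≢ y → # (λ B → I x B ∧ I y B) ≡ λA
    meets    : ∀ B B' → B ≢ B' → meet B B' ≡ 0 ⊎ meet B B' ≡ r
    classSize : ∀ B → # (inClass B) ≡ q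
    classDisjoint : ∀ B B₁ B₂ → inClass B B₁ ≡ true → inClass B B₂ ≡ true →
                    B₁ ≢ B₂ → meet B₁ B₂ ≡ 0
    classCovers : ∀ B x → Σ (Fin nB) λ B' → inClass B B' ≡ true × I x B' ≡ true

-- An enumeration of the parallel classes of D by [κ] = {1..κ}:
-- cls B is the label of the parallel class containing block B.
record ParallelEnum {q r : ℕ} (D : AffineDesign q r) (κ : ℕ) : Set where
  open AffineDesign D
  field
    cls : Fin nB → ℕ
    clsRange : ∀ B → 1 ≤ cls B × cls B ≤ κ
    clsSurj : ∀ c → 1 ≤ c → c ≤ κ → Σ (Fin nB) λ B → cls B ≡ c
    clsClass : ∀ B B' → (cls B ≡ cls B' → inClass B B' ≡ true) × (inClass B B' ≡ true → cls B ≡ cls B')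

module Construction {q r m κ : ℕ}
    (A : Fin m → Fin m → Bool) (e : Fin m → Fin m → ℕ)
    (D : Fin m → AffineDesign q r) (P : (i : Fin m) → ParallelEnum (D i) κ)
    (σ : (i j : Fin m) → Fin (AffineDesign.nB (D i)) → Fin (AffineDesign.nB (D j))) where

  open AffineDesign
  open ParallelEnum

  record SigmaOK : Set where
    field
      maps : ∀ i j → A i j ≡ true → ∀ B → cls (P i) B ≡ e i j → cls (P j) (σ i j B) ≡ e j i
      inverse : ∀ i j → i ≢ j → A i j ≡ true → ∀ B → cls (P i) B ≡ e i j → σ j i (σ i j B) ≡ B
      identity : ∀ i → A i i ≡ true → ∀ B → cls (P i) B ≡ e i i → σ i i B ≡ B

  Vertex : Set
  Vertex = Σ (Fin m) λ i → Fin (nP (D i))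

  vertices : List Vertex
  vertices = concatMap (λ i → map (λ x → (i , x)) (allFin (nP (D i)))) (allFin m)

  sameVertex : Vertex → Vertex → Bool
  sameVertex (i , x) (j , y) with i ≟ j
  ... | yes refl = ⌊ x ≟ y ⌋
  ... | no _ = false

  inImage : (i j : Fin m) → Fin (nP (D i)) → Fin (nP (D j)) → Bool
  inImage i j x y = anyFin (λ B → (cls (P i) B ≡ᵇ e i j) ∧ I (D i) x B ∧ I (D j) y (σ i j B))

  adjΓ : Vertex → Vertex → Bool
  adjΓ (i , x) (j , y) = not (sameVertex (i , x) (j , y)) ∧ A i j ∧ not (inImage i j x y)

  blockZero : Fin m → Fin m → Bool
  blockZero i j = not (anyFin (λ x → anyFin (λ y → adjΓ (i , x) (j , y))))

  adjPC : Vertex → Vertex → Bool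
  adjPC (i , x) (j , y) =
    if ⌊ i ≟ j ⌋ then adjΓ (i , x) (j , y)
    else (if blockZero i j then true else adjΓ (i , x) (j , y))

-- Divisible design graph with parameters (v,k,λ₁,λ₂,m,n) on a finite vertex
-- type V, listed (each vertex exactly once) by `vs`.

record IsDDG {V : Set} (vs : List V) (adj : V → V → Bool) (v k λ₁ λ₂ m n : ℕ) : Set where
  common : V → V → ℕ
  common x y = countB (λ z → adj x z ∧ adj z y) vs
  field
    order   : length vs ≡ v
    symm    : ∀ x y → adj x y ≡ adj y x
    irrefl  : ∀ x → adj x x ≡ false
    regular : ∀ x → countB (adj x) vs ≡ k
    class     : V → Fin m
    classSize : ∀ c → countB (λ x → ⌊ class x ≟ c ⌋) vs ≡ n
    sameClass : ∀ x y → x ≢ y → class x ≡ class y → common x y ≡ λ₁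
    diffClass : ∀ x y → class x ≢ class y → common x y ≡ λ₂

-- Off the diagonal, the block M_ij of Γ is zero exactly when A_ij = 0 (a block of an affine
-- design misses some point), and on the diagonal x lies in its own block B_i^{e(i,i)}(x).  So in
-- PC(Γ) two vertices (i,x) ≠ (j,y) are adjacent iff A_ij = 0 or y ∉ σ_{i,j}(B_i^{e(i,j)}(x)), and
-- every count splits over the parts 𝒫_h: a part contributes its q^d points minus those on the one
-- or two blocks to be avoided.  Two blocks of an affine design meet in q^{d-1} points if equal,
-- in 0 if parallel and in q^{d-2} otherwise.  For x ≠ y in 𝒫_i the two blocks avoided in 𝒫_h
-- coincide iff x and y lie on a common block of class e(i,h); as h runs over the κ neighbours of i
-- these labels run over all κ classes of 𝒟_i, so this happens for μ = (q^{d-1}-1)/(q-1) parts,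
-- the number of blocks through x and y.  For i ≠ j the two blocks lie in the different classes
-- e(h,i) ≠ e(h,j), and i, j have λ common neighbours h.  Hence
--   k + κ q^{d-1} = m q^d,   λ₁ + 2κ q^{d-1} = m q^d + μ q^{d-1},   λ₂ + 2κ q^{d-1} = m q^d + λ q^{d-2},
-- and the stated parameters follow from κ(q-1) = q^d - 1 and μ(q-1) = q^{d-1} - 1.

{-# OPTIONS --safe #-}
module Submission where

open import Defs
open import Data.Nat using (ℕ; zero; suc; _+_; _*_; _∸_; _^_; _≤_; _≡ᵇ_; z≤n; s≤s; NonZero; >-nonZero)
open import Data.Nat.Tactic.RingSolver using (solve-∀)
open import Data.Nat.Properties
open import Data.Bool using (Bool; true; false; _∧_; _∨_; not; if_then_else_)
open import Data.Bool.Properties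
  using (T-≡; ⇔→≡; ¬-not; not-injective; ∧-conicalˡ; ∧-conicalʳ; ∧-idem; ∧-identityʳ; ∨-zeroʳ)
open import Data.Fin using (Fin; zero; suc; toℕ; fromℕ<; punchIn) renaming (_≟_ to _≟ᶠ_)
open import Data.Fin.Properties using (punchInᵢ≢i; toℕ<n; toℕ-fromℕ<; toℕ-injective)
open import Data.List using (List; []; _∷_; _++_; map; concatMap; tabulate; length; allFin)
open import Data.List.Relation.Unary.Any.Properties using (any⁺; any⁻; tabulate⁺; tabulate⁻)
open import Data.Product using (Σ; _×_; _,_; proj₁; proj₂)
open import Data.Sum using (inj₁; inj₂)
open import Function using (_∘_; id; Equivalence; mk⇔)
open import Relation.Nullary using (Dec; yes; no; ¬_; contradiction)
open import Relation.Nullary.Decidable using (⌊_⌋)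
open import Relation.Binary.PropositionalEquality
open import Algebra.Properties.Semiring.Sum +-*-semiring
  using ( sum; sum-syntax; sum-cong-≗; sum-remove; sum-replicate-zero
        ; ∑-distrib-+; ∑-comm; *-distribˡ-sum; *-distribʳ-sum)

𝟙 : Bool → ℕ
𝟙 true  = 1
𝟙 false = 0

𝟙-∧ : ∀ a b → 𝟙 (a ∧ b) ≡ 𝟙 a * 𝟙 b
𝟙-∧ true  b = sym (*-identityˡ (𝟙 b))
𝟙-∧ false b = refl

𝟙-not : ∀ a → 𝟙 (not a) + 𝟙 a ≡ 1
𝟙-not true  = refl
𝟙-not false = refl

𝟙-neither : ∀ a b → 𝟙 (not a ∧ not b) + 𝟙 a + 𝟙 b ≡ 1 + 𝟙 (a ∧ b)
𝟙-neither true  true  = refl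
𝟙-neither true  false = refl
𝟙-neither false true  = refl
𝟙-neither false false = refl

sum-const : ∀ n c → ∑[ _ < n ] c ≡ n * c
sum-const zero    c = refl
sum-const (suc n) c = cong (c +_) (sum-const n c)

sum-const-except : ∀ {n c} (f : Fin n → ℕ) i → (∀ j → j ≢ i → f j ≡ c) →
                   sum f + c ≡ f i + n * c
sum-const-except {suc n} {c} f i f≡c = begin
  sum f + c                              ≡⟨ cong (_+ c) (sum-remove {i = i} f) ⟩
  f i + ∑[ j < n ] f (punchIn i j) + c   ≡⟨ cong (λ t → f i + t + c) (sum-cong-≗ (f≡c _ ∘ punchInᵢ≢i i)) ⟩
  f i + ∑[ _ < n ] c + c                 ≡⟨ cong (λ t → f i + t + c) (sum-const n c) ⟩
  f i + n * c + c                        ≡⟨ +-assoc (f i) (n * c) c ⟩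
  f i + (n * c + c)                      ≡⟨ cong (f i +_) (+-comm (n * c) c) ⟩
  f i + suc n * c                        ∎
  where open ≡-Reasoning

sum-single : ∀ {n} (f : Fin n → ℕ) i → (∀ j → j ≢ i → f j ≡ 0) → sum f ≡ f i
sum-single {n} f i f≡0 = begin
  sum f          ≡⟨ +-identityʳ (sum f) ⟨
  sum f + 0      ≡⟨ sum-const-except f i f≡0 ⟩
  f i + n * 0    ≡⟨ cong (f i +_) (*-zeroʳ n) ⟩
  f i + 0        ≡⟨ +-identityʳ (f i) ⟩
  f i            ∎
  where open ≡-Reasoning

sum-zero : ∀ {n} (f : Fin n → ℕ) → (∀ x → f x ≡ 0) → sum f ≡ 0
sum-zero {n} f f≡0 = trans (sum-cong-≗ f≡0) (sum-replicate-zero n)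

𝟙-≟-≡ : ∀ {n} {x y : Fin n} → x ≡ y → 𝟙 ⌊ x ≟ᶠ y ⌋ ≡ 1
𝟙-≟-≡ {x = x} refl with x ≟ᶠ x
... | yes _   = refl
... | no  x≢x = contradiction refl x≢x

𝟙-≟-≢ : ∀ {n} {x y : Fin n} → x ≢ y → 𝟙 ⌊ x ≟ᶠ y ⌋ ≡ 0
𝟙-≟-≢ {x = x} {y} x≢y with x ≟ᶠ y
... | yes x≡y = contradiction x≡y x≢y
... | no  _   = refl

sum-bijection : ∀ {n k} (s : Fin n → Bool) (ι : Fin k → Fin n) →
                (∀ c → s (ι c) ≡ true) → (∀ {c c′} → ι c ≡ ι c′ → c ≡ c′) →
                (∀ x → s x ≡ true → Σ (Fin k) λ c → ι c ≡ x) →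
                (g : Fin n → ℕ) → ∑[ x < n ] (𝟙 (s x) * g x) ≡ ∑[ c < k ] g (ι c)
sum-bijection {n} {k} s ι s∘ι ι-injective ι-onto g = begin
  ∑[ x < n ] (𝟙 (s x) * g x)              ≡⟨ sum-cong-≗ (λ x → cong (_* g x) (fibre x)) ⟨
  ∑[ x < n ] ((∑[ c < k ] δ c x) * g x)   ≡⟨ sum-cong-≗ (λ x → *-distribʳ-sum (g x) (λ c → δ c x)) ⟩
  ∑[ x < n ] ∑[ c < k ] (δ c x * g x)     ≡⟨ ∑-comm (λ x c → δ c x * g x) ⟩
  ∑[ c < k ] ∑[ x < n ] (δ c x * g x)     ≡⟨ sum-cong-≗ (λ c → sum-single (λ x → δ c x * g x) (ι c) (off c)) ⟩
  ∑[ c < k ] (δ c (ι c) * g (ι c))        ≡⟨ sum-cong-≗ (λ c → cong (_* g (ι c)) (𝟙-≟-≡ {x = ι c} refl)) ⟩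
  ∑[ c < k ] (1 * g (ι c))                ≡⟨ sum-cong-≗ (λ c → *-identityˡ (g (ι c))) ⟩
  ∑[ c < k ] g (ι c)                      ∎
  where
  open ≡-Reasoning
  δ : Fin k → Fin n → ℕ
  δ c x = 𝟙 ⌊ ι c ≟ᶠ x ⌋
  off : ∀ c x → x ≢ ι c → δ c x * g x ≡ 0
  off c x x≢ιc = cong (_* g x) (𝟙-≟-≢ (x≢ιc ∘ sym))
  fibre : ∀ x → ∑[ c < k ] δ c x ≡ 𝟙 (s x)
  fibre x with s x in sx
  ... | true  = let (c , ιc≡x) = ι-onto x sx in
    trans (sum-single (λ c → δ c x) c λ c′ c′≢c →
                      𝟙-≟-≢ λ ιc′≡x → c′≢c (ι-injective (trans ιc′≡x (sym ιc≡x))))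
          (𝟙-≟-≡ ιc≡x)
  ... | false = sum-zero (λ c → δ c x) λ c → 𝟙-≟-≢ λ { refl → contradiction (trans (sym (s∘ι c)) sx) λ () }

countB-tabulate : ∀ {A : Set} {n} (p : A → Bool) (f : Fin n → A) →
                  countB p (tabulate f) ≡ ∑[ x < n ] 𝟙 (p (f x))
countB-tabulate {n = zero}  p f = refl
countB-tabulate {n = suc n} p f with p (f zero)
... | true  = cong suc (countB-tabulate p (f ∘ suc))
... | false = countB-tabulate p (f ∘ suc)

countB-++ : ∀ {A : Set} (p : A → Bool) xs ys → countB p (xs ++ ys) ≡ countB p xs + countB p ys
countB-++ p []       ys = refl
countB-++ p (x ∷ xs) ys with p x
... | true  = cong suc (countB-++ p xs ys)
... | false = countB-++ p xs ys

countB-map : ∀ {A B : Set} (p : B → Bool) (g : A → B) xs → countB p (map g xs) ≡ countB (p ∘ g) xs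
countB-map p g []       = refl
countB-map p g (x ∷ xs) with p (g x)
... | true  = cong suc (countB-map p g xs)
... | false = countB-map p g xs

countB-concatMap : ∀ {A B : Set} {n} (p : B → Bool) (g : A → List B) (f : Fin n → A) →
                   countB p (concatMap g (tabulate f)) ≡ ∑[ i < n ] countB p (g (f i))
countB-concatMap {n = zero}  p g f = refl
countB-concatMap {n = suc n} p g f =
  trans (countB-++ p (g (f zero)) _) (cong (countB p (g (f zero)) +_) (countB-concatMap p g (f ∘ suc)))

countB-mono : ∀ {A : Set} {p r : A → Bool} → (∀ x → p x ≡ true → r x ≡ true) →
              ∀ xs → countB p xs ≤ countB r xs
countB-mono p⇒r [] = z≤n
countB-mono {p = p} {r} p⇒r (x ∷ xs) with p x in px | r x in rx
... | true  | true  = s≤s (countB-mono p⇒r xs)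
... | true  | false = contradiction (trans (sym (p⇒r x px)) rx) λ ()
... | false | true  = m≤n⇒m≤1+n (countB-mono p⇒r xs)
... | false | false = countB-mono p⇒r xs

countB-tabulate-witness : ∀ {A : Set} {n} (p : A → Bool) (f : Fin n → A) →
                          countB p (tabulate f) ≢ 0 → Σ (Fin n) λ x → p (f x) ≡ true
countB-tabulate-witness {n = zero}  p f ≢0 = contradiction refl ≢0
countB-tabulate-witness {n = suc n} p f ≢0 with p (f zero) in pf
... | true  = zero , pf
... | false = let (x , px) = countB-tabulate-witness p (f ∘ suc) ≢0 in suc x , px

length≡countB-true : ∀ {A : Set} (xs : List A) → length xs ≡ countB (λ _ → true) xs
length≡countB-true []       = refl
length≡countB-true (x ∷ xs) = cong suc (length≡countB-true xs)

#≡∑𝟙 : ∀ {n} (p : Fin n → Bool) → # p ≡ ∑[ x < n ] 𝟙 (p x)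
#≡∑𝟙 p = countB-tabulate p id

#-cong : ∀ {n} {p r : Fin n → Bool} → (∀ x → p x ≡ r x) → # p ≡ # r
#-cong {p = p} {r} p≡r = trans (#≡∑𝟙 p) (trans (sum-cong-≗ (cong 𝟙 ∘ p≡r)) (sym (#≡∑𝟙 r)))

#-true : ∀ n → # (λ (_ : Fin n) → true) ≡ n
#-true n = trans (#≡∑𝟙 {n} _) (trans (sum-const n 1) (*-identityʳ n))

#-const : ∀ n b → # (λ (_ : Fin n) → b) ≡ 𝟙 b * n
#-const n true  = trans (#-true n) (sym (*-identityˡ n))
#-const n false = trans (#≡∑𝟙 {n} (λ _ → false)) (sum-zero {n} (λ _ → 0) (λ _ → refl))

#-complement : ∀ {n} (p : Fin n → Bool) → # (not ∘ p) + # p ≡ n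
#-complement {n} p = begin
  # (not ∘ p) + # p                             ≡⟨ cong₂ _+_ (#≡∑𝟙 (not ∘ p)) (#≡∑𝟙 p) ⟩
  ∑[ x < n ] 𝟙 (not (p x)) + ∑[ x < n ] 𝟙 (p x) ≡⟨ ∑-distrib-+ (𝟙 ∘ not ∘ p) (𝟙 ∘ p) ⟨
  ∑[ x < n ] (𝟙 (not (p x)) + 𝟙 (p x))         ≡⟨ sum-cong-≗ (𝟙-not ∘ p) ⟩
  ∑[ x < n ] 1                                  ≡⟨ sum-const n 1 ⟩
  n * 1                                         ≡⟨ *-identityʳ n ⟩
  n                                             ∎
  where open ≡-Reasoning

#-neither : ∀ {n} (p r : Fin n → Bool) →
            # (λ x → not (p x) ∧ not (r x)) + # p + # r ≡ n + # (λ x → p x ∧ r x)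
#-neither {n} p r = begin
  # neither + # p + # r
    ≡⟨ cong₂ _+_ (cong₂ _+_ (#≡∑𝟙 neither) (#≡∑𝟙 p)) (#≡∑𝟙 r) ⟩
  ∑[ x < n ] 𝟙 (neither x) + ∑[ x < n ] 𝟙 (p x) + ∑[ x < n ] 𝟙 (r x)
    ≡⟨ cong (_+ ∑[ x < n ] 𝟙 (r x)) (∑-distrib-+ (𝟙 ∘ neither) (𝟙 ∘ p)) ⟨
  ∑[ x < n ] (𝟙 (neither x) + 𝟙 (p x)) + ∑[ x < n ] 𝟙 (r x)
    ≡⟨ ∑-distrib-+ (λ x → 𝟙 (neither x) + 𝟙 (p x)) (𝟙 ∘ r) ⟨
  ∑[ x < n ] (𝟙 (neither x) + 𝟙 (p x) + 𝟙 (r x))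
    ≡⟨ sum-cong-≗ (λ x → 𝟙-neither (p x) (r x)) ⟩
  ∑[ x < n ] (1 + 𝟙 (p x ∧ r x))
    ≡⟨ ∑-distrib-+ (λ _ → 1) (λ x → 𝟙 (p x ∧ r x)) ⟩
  ∑[ x < n ] 1 + ∑[ x < n ] 𝟙 (p x ∧ r x)
    ≡⟨ cong₂ _+_ (trans (sum-const n 1) (*-identityʳ n)) (sym (#≡∑𝟙 (λ x → p x ∧ r x))) ⟩
  n + # (λ x → p x ∧ r x)
    ∎
  where
  open ≡-Reasoning
  neither : Fin n → Bool
  neither x = not (p x) ∧ not (r x)

sum-+-#* : ∀ {n} (f : Fin n → ℕ) (p : Fin n → Bool) c →
           ∑[ h < n ] (f h + 𝟙 (p h) * c) ≡ sum f + # p * c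
sum-+-#* {n} f p c = begin
  ∑[ h < n ] (f h + 𝟙 (p h) * c)         ≡⟨ ∑-distrib-+ f (λ h → 𝟙 (p h) * c) ⟩
  sum f + ∑[ h < n ] (𝟙 (p h) * c)       ≡⟨ cong (sum f +_) (*-distribʳ-sum c (𝟙 ∘ p)) ⟨
  sum f + (∑[ h < n ] 𝟙 (p h)) * c       ≡⟨ cong (λ t → sum f + t * c) (#≡∑𝟙 p) ⟨
  sum f + # p * c                        ∎
  where open ≡-Reasoning

#-mono : ∀ {n} {p r : Fin n → Bool} → (∀ x → p x ≡ true → r x ≡ true) → # p ≤ # r
#-mono {n} p⇒r = countB-mono p⇒r (allFin n)

#-nonzero : ∀ {n} (p : Fin n → Bool) x → p x ≡ true → # p ≢ 0
#-nonzero {suc n} p x px #p≡0 = 1+n≢0 (begin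
  1 + rest                 ≡⟨ cong (λ b → 𝟙 b + rest) px ⟨
  𝟙 (p x) + rest           ≡⟨ sum-remove {i = x} (𝟙 ∘ p) ⟨
  ∑[ j < suc n ] 𝟙 (p j)   ≡⟨ #≡∑𝟙 p ⟨
  # p                      ≡⟨ #p≡0 ⟩
  0                        ∎)
  where
  open ≡-Reasoning
  rest = ∑[ j < n ] 𝟙 (p (punchIn x j))

#-witness : ∀ {n} (p : Fin n → Bool) → # p ≢ 0 → Σ (Fin n) λ x → p x ≡ true
#-witness p = countB-tabulate-witness p id

anyFin-intro : ∀ {n} (p : Fin n → Bool) x → p x ≡ true → anyFin p ≡ true
anyFin-intro p x px = Equivalence.to T-≡ (any⁺ p (tabulate⁺ x (Equivalence.from T-≡ px)))

anyFin-elim : ∀ {n} (p : Fin n → Bool) → anyFin p ≡ true → Σ (Fin n) λ x → p x ≡ true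
anyFin-elim {n} p any≡true with tabulate⁻ (any⁻ p (allFin n) (Equivalence.from T-≡ any≡true))
... | x , px = x , Equivalence.to T-≡ px

anyFin-false : ∀ {n} (p : Fin n → Bool) → (∀ x → p x ≡ false) → anyFin p ≡ false
anyFin-false p p≡false = ¬-not {y = true} λ any≡true →
  let (x , px) = anyFin-elim p any≡true in contradiction (trans (sym px) (p≡false x)) λ ()

if-dec : ∀ {P A : Set} {x y z : A} (d : Dec P) →
         (P → x ≡ z) → (¬ P → y ≡ z) → (if ⌊ d ⌋ then x else y) ≡ z
if-dec (yes p) x≡z y≡z = x≡z p
if-dec (no ¬p) x≡z y≡z = y≡z ¬p

≡⇒≡ᵇ-true : ∀ {m n} → m ≡ n → (m ≡ᵇ n) ≡ true
≡⇒≡ᵇ-true {m} {n} m≡n = Equivalence.to T-≡ (≡⇒≡ᵇ m n m≡n)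

≡ᵇ-true⇒≡ : ∀ {m n} → (m ≡ᵇ n) ≡ true → m ≡ n
≡ᵇ-true⇒≡ {m} {n} m≡ᵇn = ≡ᵇ⇒≡ m n (Equivalence.from T-≡ m≡ᵇn)

-- Parallel classes are labelled 1, …, κ; c : Fin κ stands for the label suc (toℕ c).
fin-label : ∀ {κ} (c : Fin κ) → 1 ≤ suc (toℕ c) × suc (toℕ c) ≤ κ
fin-label c = s≤s z≤n , toℕ<n c

label-fin : ∀ {κ ℓ} → 1 ≤ ℓ × ℓ ≤ κ → Σ (Fin κ) λ c → suc (toℕ c) ≡ ℓ
label-fin {ℓ = suc ℓ} (_ , ℓ<κ) = fromℕ< ℓ<κ , cong suc (toℕ-fromℕ< ℓ<κ)

module AffineDesignProperties {q r κ : ℕ}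
    (D : AffineDesign q r) (PE : ParallelEnum D κ) (2≤κ : 2 ≤ κ) where
  open AffineDesign D
  open ParallelEnum PE

  inClass⇒cls≡ : ∀ {B B′} → inClass B B′ ≡ true → cls B ≡ cls B′
  inClass⇒cls≡ {B} {B′} = proj₂ (clsClass B B′)

  cls≡⇒inClass : ∀ {B B′} → cls B ≡ cls B′ → inClass B B′ ≡ true
  cls≡⇒inClass {B} {B′} = proj₁ (clsClass B B′)

  parallel⇒disjoint : ∀ {B B′} → cls B ≡ cls B′ → B ≢ B′ → meet B B′ ≡ 0
  parallel⇒disjoint {B} {B′} B∥B′ =
    classDisjoint B B B′ (cls≡⇒inClass refl) (cls≡⇒inClass B∥B′)

  nonparallel⇒meet≡r : ∀ {B B′} → cls B ≢ cls B′ → meet B B′ ≡ r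
  nonparallel⇒meet≡r {B} {B′} B∦B′ with meets B B′ (B∦B′ ∘ cong cls)
  ... | inj₂ meet≡r = meet≡r
  ... | inj₁ meet≡0 = contradiction (inClass⇒cls≡ B∥B′) B∦B′
    where
    B∥B′ : inClass B B′ ≡ true
    B∥B′ = trans (cong (λ t → ⌊ B ≟ᶠ B′ ⌋ ∨ (t ≡ᵇ 0)) meet≡0) (∨-zeroʳ _)

  ∈-parallel⇒≡ : ∀ {B B′ x} → cls B ≡ cls B′ → I x B ≡ true → I x B′ ≡ true → B ≡ B′
  ∈-parallel⇒≡ {B} {B′} {x} B∥B′ x∈B x∈B′ with B ≟ᶠ B′
  ... | yes B≡B′ = B≡B′
  ... | no  B≢B′ = contradiction (parallel⇒disjoint B∥B′ B≢B′)
                                 (#-nonzero (λ y → I y B ∧ I y B′) x (cong₂ _∧_ x∈B x∈B′))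

  blockThrough : ∀ {c} → 1 ≤ c × c ≤ κ → ∀ x → Σ (Fin nB) λ B → cls B ≡ c × I x B ≡ true
  blockThrough (1≤c , c≤κ) x with clsSurj _ 1≤c c≤κ
  ... | B₀ , clsB₀≡c with classCovers B₀ x
  ... | B , B₀∥B , x∈B = B , trans (sym (inClass⇒cls≡ B₀∥B)) clsB₀≡c , x∈B

  blockOf : ∀ {c} → 1 ≤ c × c ≤ κ → Fin nP → Fin nB
  blockOf c∈ x = proj₁ (blockThrough c∈ x)

  cls-blockOf : ∀ {c} (c∈ : 1 ≤ c × c ≤ κ) x → cls (blockOf c∈ x) ≡ c
  cls-blockOf c∈ x = proj₁ (proj₂ (blockThrough c∈ x))

  ∈-blockOf : ∀ {c} (c∈ : 1 ≤ c × c ≤ κ) x → I x (blockOf c∈ x) ≡ true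
  ∈-blockOf c∈ x = proj₂ (proj₂ (blockThrough c∈ x))

  blockOf-unique : ∀ {c B x} (c∈ : 1 ≤ c × c ≤ κ) → cls B ≡ c → I x B ≡ true → B ≡ blockOf c∈ x
  blockOf-unique {x = x} c∈ clsB≡c x∈B =
    ∈-parallel⇒≡ (trans clsB≡c (sym (cls-blockOf c∈ x))) x∈B (∈-blockOf c∈ x)

  anyFin-blockOf : ∀ {c} (c∈ : 1 ≤ c × c ≤ κ) x (J : Fin nB → Bool) →
                   anyFin (λ B → (cls B ≡ᵇ c) ∧ I x B ∧ J B) ≡ J (blockOf c∈ x)
  anyFin-blockOf {c} c∈ x J = ⇔→≡ (mk⇔ to from)
    where
    to : anyFin (λ B → (cls B ≡ᵇ c) ∧ I x B ∧ J B) ≡ true → J (blockOf c∈ x) ≡ true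
    to any≡true with anyFin-elim _ any≡true
    ... | B , hit = subst (λ B → J B ≡ true) (blockOf-unique c∈ (≡ᵇ-true⇒≡ clsB≡ᵇc) x∈B) JB
      where
      clsB≡ᵇc = ∧-conicalˡ (cls B ≡ᵇ c) _ hit
      x∈B     = ∧-conicalˡ (I x B) (J B) (∧-conicalʳ (cls B ≡ᵇ c) _ hit)
      JB      = ∧-conicalʳ (I x B) (J B) (∧-conicalʳ (cls B ≡ᵇ c) _ hit)
    from : J (blockOf c∈ x) ≡ true → anyFin (λ B → (cls B ≡ᵇ c) ∧ I x B ∧ J B) ≡ true
    from JB = anyFin-intro _ (blockOf c∈ x)
      (cong₂ _∧_ (≡⇒≡ᵇ-true (cls-blockOf c∈ x)) (cong₂ _∧_ (∈-blockOf c∈ x) JB))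

  sum-over-class : ∀ {c} → 1 ≤ c × c ≤ κ → (f : Fin nP → ℕ) →
                   ∑[ x < nP ] f x ≡ ∑[ B < nB ] (𝟙 (cls B ≡ᵇ c) * ∑[ x < nP ] (𝟙 (I x B) * f x))
  sum-over-class {c} c∈ f = begin
    ∑[ x < nP ] f x
      ≡⟨ sum-cong-≗ (λ x → trans (cong (_* f x) (covered x)) (*-identityˡ (f x))) ⟨
    ∑[ x < nP ] ((∑[ B < nB ] (𝟙 (cls B ≡ᵇ c) * 𝟙 (I x B))) * f x)
      ≡⟨ sum-cong-≗ (λ x → *-distribʳ-sum (f x) (λ B → 𝟙 (cls B ≡ᵇ c) * 𝟙 (I x B))) ⟩
    ∑[ x < nP ] ∑[ B < nB ] (𝟙 (cls B ≡ᵇ c) * 𝟙 (I x B) * f x)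
      ≡⟨ ∑-comm (λ x B → 𝟙 (cls B ≡ᵇ c) * 𝟙 (I x B) * f x) ⟩
    ∑[ B < nB ] ∑[ x < nP ] (𝟙 (cls B ≡ᵇ c) * 𝟙 (I x B) * f x)
      ≡⟨ sum-cong-≗ (λ B → sum-cong-≗ (λ x → *-assoc (𝟙 (cls B ≡ᵇ c)) (𝟙 (I x B)) (f x))) ⟩
    ∑[ B < nB ] ∑[ x < nP ] (𝟙 (cls B ≡ᵇ c) * (𝟙 (I x B) * f x))
      ≡⟨ sum-cong-≗ (λ B → *-distribˡ-sum (𝟙 (cls B ≡ᵇ c)) (λ x → 𝟙 (I x B) * f x)) ⟨
    ∑[ B < nB ] (𝟙 (cls B ≡ᵇ c) * ∑[ x < nP ] (𝟙 (I x B) * f x))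
      ∎
    where
    open ≡-Reasoning
    elsewhere : ∀ x B → B ≢ blockOf c∈ x → 𝟙 (cls B ≡ᵇ c) * 𝟙 (I x B) ≡ 0
    elsewhere x B B≢ with cls B ≡ᵇ c in clsB≡ᵇc | I x B in x∈B
    ... | true  | true  = contradiction (blockOf-unique c∈ (≡ᵇ-true⇒≡ clsB≡ᵇc) x∈B) B≢
    ... | true  | false = refl
    ... | false | _     = refl
    covered : ∀ x → ∑[ B < nB ] (𝟙 (cls B ≡ᵇ c) * 𝟙 (I x B)) ≡ 1
    covered x = trans (sum-single _ (blockOf c∈ x) (elsewhere x))
      (cong₂ (λ a b → 𝟙 a * 𝟙 b) (≡⇒≡ᵇ-true (cls-blockOf c∈ x)) (∈-blockOf c∈ x))

  #-class : ∀ {c} → 1 ≤ c × c ≤ κ → # (λ B → cls B ≡ᵇ c) ≡ q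
  #-class {c} (1≤c , c≤κ) with clsSurj c 1≤c c≤κ
  ... | B₀ , clsB₀≡c = trans (#-cong inClassB₀) (classSize B₀)
    where
    inClassB₀ : ∀ B → (cls B ≡ᵇ c) ≡ inClass B₀ B
    inClassB₀ B = ⇔→≡ (mk⇔
      (λ clsB≡ᵇc → cls≡⇒inClass (trans clsB₀≡c (sym (≡ᵇ-true⇒≡ clsB≡ᵇc))))
      (λ B₀∥B → ≡⇒≡ᵇ-true (trans (sym (inClass⇒cls≡ B₀∥B)) clsB₀≡c)))

  another-label : ∀ B → Σ ℕ λ c → (1 ≤ c × c ≤ κ) × cls B ≢ c
  another-label B with cls B ≟ 1
  ... | yes clsB≡1 = 2 , (s≤s z≤n , 2≤κ) , λ clsB≡2 → contradiction (trans (sym clsB≡1) clsB≡2) λ ()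
  ... | no  clsB≢1 = 1 , (s≤s z≤n , ≤-trans (s≤s z≤n) 2≤κ) , clsB≢1

  size : ∀ B → # (λ x → I x B) ≡ q * r
  size B with another-label B
  ... | c , c∈ , clsB≢c = begin
    # (λ x → I x B)                                           ≡⟨ #≡∑𝟙 (λ x → I x B) ⟩
    ∑[ x < nP ] 𝟙 (I x B)                                     ≡⟨ sum-over-class c∈ _ ⟩
    ∑[ B′ < nB ] (inC B′ * ∑[ x < nP ] (𝟙 (I x B′) * 𝟙 (I x B)))  ≡⟨ sum-cong-≗ meets-r ⟩
    ∑[ B′ < nB ] (inC B′ * r)                                 ≡⟨ *-distribʳ-sum r inC ⟨
    (∑[ B′ < nB ] inC B′) * r                                 ≡⟨ cong (_* r) (#≡∑𝟙 (λ B′ → cls B′ ≡ᵇ c)) ⟨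
    # (λ B′ → cls B′ ≡ᵇ c) * r                                ≡⟨ cong (_* r) (#-class c∈) ⟩
    q * r                                                     ∎
    where
    open ≡-Reasoning
    inC : Fin nB → ℕ
    inC B′ = 𝟙 (cls B′ ≡ᵇ c)
    meets-r : ∀ B′ → inC B′ * ∑[ x < nP ] (𝟙 (I x B′) * 𝟙 (I x B)) ≡ inC B′ * r
    meets-r B′ with cls B′ ≡ᵇ c in clsB′≡ᵇc
    ... | false = refl
    ... | true  = cong (1 *_) (begin
      ∑[ x < nP ] (𝟙 (I x B′) * 𝟙 (I x B))  ≡⟨ sum-cong-≗ (λ x → 𝟙-∧ (I x B′) (I x B)) ⟨
      ∑[ x < nP ] 𝟙 (I x B′ ∧ I x B)        ≡⟨ #≡∑𝟙 (λ x → I x B′ ∧ I x B) ⟨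
      meet B′ B                             ≡⟨ nonparallel⇒meet≡r B′∦B ⟩
      r                                     ∎)
      where
      B′∦B : cls B′ ≢ cls B
      B′∦B B′∥B = clsB≢c (trans (sym B′∥B) (≡ᵇ-true⇒≡ clsB′≡ᵇc))

  points : nP ≡ q * (q * r)
  points = begin
    nP                                              ≡⟨ #-true nP ⟨
    # (λ (_ : Fin nP) → true)                       ≡⟨ #≡∑𝟙 {nP} (λ _ → true) ⟩
    ∑[ x < nP ] 1                                   ≡⟨ sum-over-class class₁ _ ⟩
    ∑[ B < nB ] (inC₁ B * ∑[ x < nP ] (𝟙 (I x B) * 1))  ≡⟨ sum-cong-≗ (λ B → cong (inC₁ B *_) (size′ B)) ⟩
    ∑[ B < nB ] (inC₁ B * (q * r))                  ≡⟨ *-distribʳ-sum (q * r) inC₁ ⟨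
    (∑[ B < nB ] inC₁ B) * (q * r)                  ≡⟨ cong (_* (q * r)) (#≡∑𝟙 (λ B → cls B ≡ᵇ 1)) ⟨
    # (λ B → cls B ≡ᵇ 1) * (q * r)                  ≡⟨ cong (_* (q * r)) (#-class class₁) ⟩
    q * (q * r)                                     ∎
    where
    open ≡-Reasoning
    class₁ : 1 ≤ 1 × 1 ≤ κ
    class₁ = s≤s z≤n , ≤-trans (s≤s z≤n) 2≤κ
    inC₁ : Fin nB → ℕ
    inC₁ B = 𝟙 (cls B ≡ᵇ 1)
    size′ : ∀ B → ∑[ x < nP ] (𝟙 (I x B) * 1) ≡ q * r
    size′ B = trans (sum-cong-≗ (λ x → *-identityʳ (𝟙 (I x B))))
                    (trans (sym (#≡∑𝟙 (λ x → I x B))) (size B))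

  sum-blocks-through : ∀ x (g : Fin nB → ℕ) →
                       ∑[ B < nB ] (𝟙 (I x B) * g B) ≡ ∑[ c < κ ] g (blockOf (fin-label c) x)
  sum-blocks-through x = sum-bijection (λ B → I x B) (λ c → blockOf (fin-label c) x)
    (λ c → ∈-blockOf (fin-label c) x) injective onto
    where
    injective : ∀ {c c′} → blockOf (fin-label c) x ≡ blockOf (fin-label c′) x → c ≡ c′
    injective {c} {c′} same = toℕ-injective (suc-injective (begin
      suc (toℕ c)                       ≡⟨ cls-blockOf (fin-label c) x ⟨
      cls (blockOf (fin-label c) x)     ≡⟨ cong cls same ⟩
      cls (blockOf (fin-label c′) x)    ≡⟨ cls-blockOf (fin-label c′) x ⟩
      suc (toℕ c′)                      ∎))
      where open ≡-Reasoning
    onto : ∀ B → I x B ≡ true → Σ (Fin κ) λ c → blockOf (fin-label c) x ≡ B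
    onto B x∈B with label-fin (clsRange B)
    ... | c , c≡clsB = c , sym (blockOf-unique (fin-label c) (sym c≡clsB) x∈B)

  replication : ∀ x → # (λ B → I x B) ≡ κ
  replication x = begin
    # (λ B → I x B)                          ≡⟨ #≡∑𝟙 (λ B → I x B) ⟩
    ∑[ B < nB ] 𝟙 (I x B)                    ≡⟨ sum-cong-≗ (λ B → *-identityʳ (𝟙 (I x B))) ⟨
    ∑[ B < nB ] (𝟙 (I x B) * 1)              ≡⟨ sum-blocks-through x (λ _ → 1) ⟩
    ∑[ c < κ ] 1                             ≡⟨ sum-const κ 1 ⟩
    κ * 1                                    ≡⟨ *-identityʳ κ ⟩
    κ                                        ∎
    where open ≡-Reasoning

  onCommonBlock : ℕ → Fin nP → Fin nP → Bool
  onCommonBlock c x y = anyFin (λ B → (cls B ≡ᵇ c) ∧ I x B ∧ I y B)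

  #-blocks-through-both : ∀ x y →
    # (λ B → I x B ∧ I y B) ≡ # (λ (c : Fin κ) → onCommonBlock (suc (toℕ c)) x y)
  #-blocks-through-both x y = begin
    # (λ B → I x B ∧ I y B)
      ≡⟨ #≡∑𝟙 (λ B → I x B ∧ I y B) ⟩
    ∑[ B < nB ] 𝟙 (I x B ∧ I y B)
      ≡⟨ sum-cong-≗ (λ B → 𝟙-∧ (I x B) (I y B)) ⟩
    ∑[ B < nB ] (𝟙 (I x B) * 𝟙 (I y B))
      ≡⟨ sum-blocks-through x (λ B → 𝟙 (I y B)) ⟩
    ∑[ c < κ ] 𝟙 (I y (blockOf (fin-label c) x))
      ≡⟨ sum-cong-≗ (λ c → cong 𝟙 (anyFin-blockOf (fin-label c) x (I y))) ⟨
    ∑[ c < κ ] 𝟙 (onCommonBlock (suc (toℕ c)) x y)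
      ≡⟨ #≡∑𝟙 {κ} (λ c → onCommonBlock (suc (toℕ c)) x y) ⟨
    # (λ (c : Fin κ) → onCommonBlock (suc (toℕ c)) x y)
      ∎
    where open ≡-Reasoning

  λA-relation : Fin nP → suc (κ * (q ∸ 1)) ≡ q * (q * r) → suc (λA * (q ∸ 1)) ≡ q * r
  λA-relation x hκ = sym (*-cancelˡ-≡ (q * r) (suc (λA * (q ∸ 1))) κ {{κ≢0}} (+-cancelʳ-≡ λA _ _ (begin
    κ * (q * r) + λA                     ≡⟨ cong (_+ λA) flags-by-block ⟨
    flags + λA                           ≡⟨ flags-by-point ⟩
    κ + nP * λA                          ≡⟨ cong (λ n → κ + n * λA) (trans points (sym hκ)) ⟩
    κ + suc (κ * (q ∸ 1)) * λA           ≡⟨ ring κ (q ∸ 1) λA ⟩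
    κ * suc (λA * (q ∸ 1)) + λA          ∎)))
    where
    open ≡-Reasoning
    κ≢0 : NonZero κ
    κ≢0 = >-nonZero (≤-trans (s≤s z≤n) 2≤κ)
    ring : ∀ κ p λ′ → κ + suc (κ * p) * λ′ ≡ κ * suc (λ′ * p) + λ′
    ring = solve-∀
    flags : ℕ
    flags = ∑[ y < nP ] # (λ B → I x B ∧ I y B)
    flags-by-point : flags + λA ≡ κ + nP * λA
    flags-by-point = begin
      flags + λA
        ≡⟨ sum-const-except (λ y → # (λ B → I x B ∧ I y B)) x (λ y y≢x → balanced x y (y≢x ∘ sym)) ⟩
      # (λ B → I x B ∧ I x B) + nP * λA
        ≡⟨ cong (_+ nP * λA) (trans (#-cong (λ B → ∧-idem (I x B))) (replication x)) ⟩
      κ + nP * λA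
        ∎
    flags-by-block : flags ≡ κ * (q * r)
    flags-by-block = begin
      flags
        ≡⟨ sum-cong-≗ (λ y → trans (#≡∑𝟙 (λ B → I x B ∧ I y B)) (sum-cong-≗ (λ B → 𝟙-∧ (I x B) (I y B)))) ⟩
      ∑[ y < nP ] ∑[ B < nB ] (𝟙 (I x B) * 𝟙 (I y B))
        ≡⟨ ∑-comm (λ y B → 𝟙 (I x B) * 𝟙 (I y B)) ⟩
      ∑[ B < nB ] ∑[ y < nP ] (𝟙 (I x B) * 𝟙 (I y B))
        ≡⟨ sum-cong-≗ (λ B → *-distribˡ-sum (𝟙 (I x B)) (λ y → 𝟙 (I y B))) ⟨
      ∑[ B < nB ] (𝟙 (I x B) * ∑[ y < nP ] 𝟙 (I y B))
        ≡⟨ sum-cong-≗ (λ B → cong (𝟙 (I x B) *_) (trans (sym (#≡∑𝟙 (λ y → I y B))) (size B))) ⟩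
      ∑[ B < nB ] (𝟙 (I x B) * (q * r))
        ≡⟨ sum-blocks-through x (λ _ → q * r) ⟩
      ∑[ c < κ ] (q * r)
        ≡⟨ sum-const κ (q * r) ⟩
      κ * (q * r)
        ∎

  #-outside : ∀ B → # (λ x → not (I x B)) + q * r ≡ q * (q * r)
  #-outside B = begin
    # (λ x → not (I x B)) + q * r              ≡⟨ cong (# (λ x → not (I x B)) +_) (size B) ⟨
    # (λ x → not (I x B)) + # (λ x → I x B)    ≡⟨ #-complement (λ x → I x B) ⟩
    nP                                         ≡⟨ points ⟩
    q * (q * r)                                ∎
    where open ≡-Reasoning

  #-outside-both : ∀ B B′ →
    # (λ x → not (I x B) ∧ not (I x B′)) + q * r + q * r ≡ q * (q * r) + meet B B′
  #-outside-both B B′ = begin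
    # (λ x → not (I x B) ∧ not (I x B′)) + q * r + q * r
      ≡⟨ cong₂ (λ s t → # (λ x → not (I x B) ∧ not (I x B′)) + s + t) (size B) (size B′) ⟨
    # (λ x → not (I x B) ∧ not (I x B′)) + # (λ x → I x B) + # (λ x → I x B′)
      ≡⟨ #-neither (λ x → I x B) (λ x → I x B′) ⟩
    nP + meet B B′
      ≡⟨ cong (_+ meet B B′) points ⟩
    q * (q * r) + meet B B′
      ∎
    where open ≡-Reasoning

  outside-point : 2 ≤ q → 1 ≤ r → ∀ B → Σ (Fin nP) λ x → I x B ≡ false
  outside-point 2≤q 1≤r B with #-witness (λ x → not (I x B)) outside≢0
    where
    instance
      qr≢0 : NonZero (q * r)
      qr≢0 = m*n≢0 q r {{>-nonZero (≤-trans (s≤s z≤n) 2≤q)}} {{>-nonZero 1≤r}}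
    outside≢0 : # (λ x → not (I x B)) ≢ 0
    outside≢0 outside≡0 = <⇒≢ 2≤q (*-cancelʳ-≡ 1 q (q * r) (begin
      1 * (q * r)                         ≡⟨ *-identityˡ (q * r) ⟩
      q * r                               ≡⟨ cong (_+ q * r) outside≡0 ⟨
      # (λ x → not (I x B)) + q * r       ≡⟨ #-outside B ⟩
      q * (q * r)                         ∎))
      where open ≡-Reasoning
  ... | x , x∉B = x , not-injective x∉B

module SymmetricDesignProperties {m κ lam : ℕ} {A : Fin m → Fin m → Bool}
    (A-design : IsSymDesign m κ lam A) (A-sym : ∀ i j → A i j ≡ A j i) where

  #-row : ∀ i → # (λ j → A i j) ≡ κ
  #-row i = trans (#-cong (A-sym i)) (IsSymDesign.blockSize A-design i)

  κ≤m : Fin m → κ ≤ m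
  κ≤m i = subst₂ _≤_ (#-row i) (#-true m) (#-mono {m} {A i} (λ _ _ → refl))

  lam≤κ : ∀ {i j} → i ≢ j → lam ≤ κ
  lam≤κ {i} {j} i≢j = subst₂ _≤_ (IsSymDesign.balanced A-design i j i≢j) (#-row i)
                                 (#-mono (λ h → ∧-conicalˡ (A i h) (A j h)))

  2κ≤m+lam : ∀ {i j} → i ≢ j → 2 * κ ≤ m + lam
  2κ≤m+lam {i} {j} i≢j = begin
    2 * κ                         ≡⟨ cong (κ +_) (+-identityʳ κ) ⟩
    κ + κ                         ≤⟨ m≤n+m (κ + κ) neither ⟩
    neither + (κ + κ)             ≡⟨ +-assoc neither κ κ ⟨
    neither + κ + κ               ≡⟨ cong₂ (λ s t → neither + s + t) (#-row i) (#-row j) ⟨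
    neither + # (A i) + # (A j)   ≡⟨ #-neither (A i) (A j) ⟩
    m + # (λ h → A i h ∧ A j h)   ≡⟨ cong (m +_) (IsSymDesign.balanced A-design i j i≢j) ⟩
    m + lam                       ∎
    where
    open ≤-Reasoning
    neither = # (λ h → not (A i h) ∧ not (A j h))

module PCGraph {q r m κ lam : ℕ}
    {A : Fin m → Fin m → Bool} {e : Fin m → Fin m → ℕ}
    {D : Fin m → AffineDesign q r} {P : (i : Fin m) → ParallelEnum (D i) κ}
    {σ : (i j : Fin m) → Fin (AffineDesign.nB (D i)) → Fin (AffineDesign.nB (D j))}
    (A-design : IsSymDesign m κ lam A) (A-sym : ∀ i j → A i j ≡ A j i) (lab : IsLabelling m κ A e)
    (σ-ok : Construction.SigmaOK A e D P σ)
    (diagonal : ∀ i → Construction.blockZero A e D P σ i i ≡ false)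
    (2≤q : 2 ≤ q) (1≤r : 1 ≤ r) (2≤κ : 2 ≤ κ) where

  open Construction A e D P σ
  open Construction.SigmaOK σ-ok
  open IsLabelling lab
  open SymmetricDesignProperties A-design A-sym using (#-row)
  open AffineDesign using (nP; nB; I; meet)
  open ParallelEnum using (cls)
  module 𝒟 (i : Fin m) = AffineDesignProperties (D i) (P i) 2≤κ

  A-refl : ∀ i → A i i ≡ true
  A-refl i with anyFin-elim _ (not-injective (diagonal i))
  ... | x , adjacent with anyFin-elim _ adjacent
  ... | y , xy-adjacent =
    ∧-conicalˡ (A i i) _ (∧-conicalʳ (not (sameVertex (i , x) (i , y))) _ xy-adjacent)

  blockFacing : ∀ {i j} → A i j ≡ true → Fin (nP (D i)) → Fin (nB (D i))
  blockFacing {i} {j} a = 𝒟.blockOf i (range i j a)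

  cls-blockFacing : ∀ {i j} (a : A i j ≡ true) x → cls (P i) (blockFacing a x) ≡ e i j
  cls-blockFacing {i} {j} a = 𝒟.cls-blockOf i (range i j a)

  ∈-blockFacing : ∀ {i j} (a : A i j ≡ true) x → I (D i) x (blockFacing a x) ≡ true
  ∈-blockFacing {i} {j} a = 𝒟.∈-blockOf i (range i j a)

  image : ∀ i j → A i j ≡ true → Fin (nP (D i)) → Fin (nB (D j))
  image i j a x = σ i j (blockFacing a x)

  inImage≡∈image : ∀ {i j} (a : A i j ≡ true) x y → inImage i j x y ≡ I (D j) y (image i j a x)
  inImage≡∈image {i} {j} a x y = 𝒟.anyFin-blockOf i (range i j a) x (λ B → I (D j) y (σ i j B))

  cls-image : ∀ {i j} (a : A i j ≡ true) x → cls (P j) (image i j a x) ≡ e j i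
  cls-image {i} {j} a x = maps i j a _ (cls-blockFacing a x)

  σ-back : ∀ {i j} → A i j ≡ true → ∀ B → cls (P i) B ≡ e i j → σ j i (σ i j B) ≡ B
  σ-back {i} {j} a B clsB with i ≟ᶠ j
  ... | yes refl = trans (cong (σ i i) (identity i a B clsB)) (identity i a B clsB)
  ... | no  i≢j  = inverse i j i≢j a B clsB

  ∈-image-sym : ∀ {i j x y} (a : A i j ≡ true) (a′ : A j i ≡ true) →
                I (D j) y (image i j a x) ≡ true → I (D i) x (image j i a′ y) ≡ true
  ∈-image-sym {i} {j} {x} {y} a a′ y∈image =
    subst (λ B → I (D i) x B ≡ true) (sym image-back) (∈-blockFacing a x)
    where
    image≡blockOf : image i j a x ≡ 𝒟.blockOf j (range j i a′) y
    image≡blockOf = 𝒟.blockOf-unique j (range j i a′) (cls-image a x) y∈image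
    image-back : image j i a′ y ≡ blockFacing a x
    image-back = trans (cong (σ j i) (sym image≡blockOf)) (σ-back a _ (cls-blockFacing a x))

  inImage-sym : ∀ {i j} → A i j ≡ true → A j i ≡ true → ∀ x y → inImage i j x y ≡ inImage j i y x
  inImage-sym {i} {j} a a′ x y = begin
    inImage i j x y              ≡⟨ inImage≡∈image a x y ⟩
    I (D j) y (image i j a x)    ≡⟨ ⇔→≡ (mk⇔ (∈-image-sym a a′) (∈-image-sym a′ a)) ⟩
    I (D i) x (image j i a′ y)   ≡⟨ inImage≡∈image a′ y x ⟨
    inImage j i y x              ∎
    where open ≡-Reasoning

  inImage-refl : ∀ i x → inImage i i x x ≡ true
  inImage-refl i x = trans (inImage≡∈image (A-refl i) x x)
    (subst (λ B → I (D i) x B ≡ true) (sym (identity i (A-refl i) _ (cls-blockFacing (A-refl i) x)))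
           (∈-blockFacing (A-refl i) x))

  adj : Vertex → Vertex → Bool
  adj (i , x) (j , y) = if A i j then not (inImage i j x y) else true

  adj-sym : ∀ v w → adj v w ≡ adj w v
  adj-sym (i , x) (j , y) with A i j in a | A j i in a′
  ... | true  | true  = cong not (inImage-sym a a′ x y)
  ... | false | false = refl
  ... | true  | false = contradiction (trans (sym a) (trans (A-sym i j) a′)) λ ()
  ... | false | true  = contradiction (trans (sym a′) (trans (A-sym j i) a)) λ ()

  adj-irrefl : ∀ v → adj v v ≡ false
  adj-irrefl (i , x) rewrite A-refl i | inImage-refl i x = refl

  sameVertex-refl : ∀ i x y → sameVertex (i , x) (i , y) ≡ ⌊ x ≟ᶠ y ⌋
  sameVertex-refl i x y with i ≟ᶠ i
  ... | yes refl = refl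
  ... | no  i≢i  = contradiction refl i≢i

  sameVertex-≢ : ∀ {i j} x y → i ≢ j → sameVertex (i , x) (j , y) ≡ false
  sameVertex-≢ {i} {j} x y i≢j with i ≟ᶠ j
  ... | yes i≡j = contradiction i≡j i≢j
  ... | no  _   = refl

  blockZero-offDiagonal : ∀ {i j} → Fin (nP (D i)) → i ≢ j → blockZero i j ≡ not (A i j)
  blockZero-offDiagonal {i} {j} x i≢j = edge-or-not (A i j) refl
    where
    edge-or-not : ∀ b → A i j ≡ b → blockZero i j ≡ not b
    edge-or-not false a = cong not (anyFin-false _ λ x → anyFin-false _ λ y → nonadjacent x y)
      where
      nonadjacent : ∀ x y → adjΓ (i , x) (j , y) ≡ false
      nonadjacent x y rewrite sameVertex-≢ x y i≢j | a = refl
    edge-or-not true a with 𝒟.outside-point j 2≤q 1≤r (image i j a x)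
    ... | y , y∉image = cong not (anyFin-intro _ x (anyFin-intro _ y adjacent))
      where
      adjacent : adjΓ (i , x) (j , y) ≡ true
      adjacent = trans (cong (λ s → not s ∧ A i j ∧ not (inImage i j x y)) (sameVertex-≢ x y i≢j))
                       (cong₂ (λ b c → b ∧ not c) a (trans (inImage≡∈image a x y) y∉image))

  adjΓ-diagonal : ∀ i x y → adjΓ (i , x) (i , y) ≡ adj (i , x) (i , y)
  adjΓ-diagonal i x y rewrite sameVertex-refl i x y | A-refl i with x ≟ᶠ y
  ... | yes refl rewrite inImage-refl i x = refl
  ... | no  _    = refl

  adjPC-offDiagonal : ∀ {i j} x y → i ≢ j →
    (if blockZero i j then true else adjΓ (i , x) (j , y)) ≡ adj (i , x) (j , y)
  adjPC-offDiagonal {i} {j} x y i≢j rewrite blockZero-offDiagonal x i≢j | sameVertex-≢ x y i≢j with A i j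
  ... | true  = refl
  ... | false = refl

  -- if-dec rather than `with i ≟ᶠ j`, which would also abstract the copies of i ≟ᶠ j inside
  -- sameVertex and blockZero.
  adjPC≡adj : ∀ v w → adjPC v w ≡ adj v w
  adjPC≡adj (i , x) (j , y) = if-dec (i ≟ᶠ j) (λ { refl → adjΓ-diagonal i x y }) (adjPC-offDiagonal x y)

  #-row-labels : ∀ i (g : ℕ → Bool) → # (λ h → A i h ∧ g (e i h)) ≡ # (λ (c : Fin κ) → g (suc (toℕ c)))
  #-row-labels i g = begin
    # (λ h → A i h ∧ g (e i h))              ≡⟨ #≡∑𝟙 (λ h → A i h ∧ g (e i h)) ⟩
    ∑[ h < m ] 𝟙 (A i h ∧ g (e i h))         ≡⟨ sum-cong-≗ (λ h → 𝟙-∧ (A i h) (g (e i h))) ⟩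
    ∑[ h < m ] (𝟙 (A i h) * 𝟙 (g (e i h)))   ≡⟨ sum-bijection (A i) ι ι-edge ι-injective ι-onto (𝟙 ∘ g ∘ e i) ⟩
    ∑[ c < κ ] 𝟙 (g (e i (ι c)))             ≡⟨ sum-cong-≗ (λ c → cong (𝟙 ∘ g) (e-ι c)) ⟩
    ∑[ c < κ ] 𝟙 (g (suc (toℕ c)))           ≡⟨ #≡∑𝟙 {κ} (λ c → g (suc (toℕ c))) ⟨
    # (λ (c : Fin κ) → g (suc (toℕ c)))      ∎
    where
    open ≡-Reasoning
    labelled : ∀ c → Σ (Fin m) λ h → A i h ≡ true × e i h ≡ suc (toℕ c)
    labelled c = surjective i (suc (toℕ c)) (proj₁ (fin-label c)) (proj₂ (fin-label c))
    ι : Fin κ → Fin m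
    ι c = proj₁ (labelled c)
    ι-edge : ∀ c → A i (ι c) ≡ true
    ι-edge c = proj₁ (proj₂ (labelled c))
    e-ι : ∀ c → e i (ι c) ≡ suc (toℕ c)
    e-ι c = proj₂ (proj₂ (labelled c))
    ι-injective : ∀ {c c′} → ι c ≡ ι c′ → c ≡ c′
    ι-injective {c} {c′} ιc≡ιc′ =
      toℕ-injective (suc-injective (trans (sym (e-ι c)) (trans (cong (e i) ιc≡ιc′) (e-ι c′))))
    ι-onto : ∀ h → A i h ≡ true → Σ (Fin κ) λ c → ι c ≡ h
    ι-onto h a with label-fin (range i h a)
    ... | c , c≡eih = c , injective i (ι c) h (ι-edge c) a (trans (e-ι c) c≡eih)

  count-vertices : ∀ (p : Vertex → Bool) → countB p vertices ≡ ∑[ i < m ] # (λ x → p (i , x))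
  count-vertices p = trans (countB-concatMap p (λ i → map (i ,_) (allFin (nP (D i)))) id)
                           (sum-cong-≗ (λ i → countB-map p (i ,_) (allFin (nP (D i)))))

  part-degree : ∀ i x j → # (λ y → adj (i , x) (j , y)) + 𝟙 (A i j) * (q * r) ≡ q * (q * r)
  part-degree i x j with A i j in a
  ... | false = trans (+-identityʳ _) (trans (#-true _) (𝒟.points j))
  ... | true  = begin
    # (λ y → not (inImage i j x y)) + 1 * (q * r)
      ≡⟨ cong₂ _+_ (#-cong (λ y → cong not (inImage≡∈image a x y))) (*-identityˡ (q * r)) ⟩
    # (λ y → not (I (D j) y (image i j a x))) + q * r
      ≡⟨ 𝒟.#-outside j (image i j a x) ⟩
    q * (q * r)
      ∎
    where open ≡-Reasoning

  meet-images : ∀ {i h} (a : A i h ≡ true) x y →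
                meet (D h) (image i h a x) (image i h a y) ≡ 𝟙 (I (D i) y (blockFacing a x)) * (q * r)
  meet-images {i} {h} a x y with I (D i) y (blockFacing a x) in y∈Bx
  ... | true  = begin
    meet (D h) (image i h a x) (image i h a y)   ≡⟨ cong (meet (D h) (image i h a x) ∘ σ i h) Bx≡By ⟨
    meet (D h) (image i h a x) (image i h a x)   ≡⟨ #-cong (λ z → ∧-idem (I (D h) z (image i h a x))) ⟩
    # (λ z → I (D h) z (image i h a x))          ≡⟨ 𝒟.size h (image i h a x) ⟩
    q * r                                        ≡⟨ *-identityˡ (q * r) ⟨
    1 * (q * r)                                  ∎
    where
    open ≡-Reasoning
    Bx≡By : blockFacing a x ≡ blockFacing a y
    Bx≡By = 𝒟.blockOf-unique i (range i h a) (cls-blockFacing a x) y∈Bx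
  ... | false = 𝒟.parallel⇒disjoint h (trans (cls-image a x) (sym (cls-image a y))) images-differ
    where
    images-differ : image i h a x ≢ image i h a y
    images-differ same =
      contradiction (trans (sym y∈Bx) (trans (cong (I (D i) y) Bx≡By) (∈-blockFacing a y))) λ ()
      where
      Bx≡By : blockFacing a x ≡ blockFacing a y
      Bx≡By = begin
        blockFacing a x                    ≡⟨ σ-back a _ (cls-blockFacing a x) ⟨
        σ h i (image i h a x)              ≡⟨ cong (σ h i) same ⟩
        σ h i (image i h a y)              ≡⟨ σ-back a _ (cls-blockFacing a y) ⟩
        blockFacing a y                    ∎
        where open ≡-Reasoning

  part-sameClass : ∀ i x y h →
    # (λ z → adj (i , x) (h , z) ∧ adj (i , y) (h , z)) + 𝟙 (A i h) * (q * r + q * r)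
      ≡ q * (q * r) + 𝟙 (A i h ∧ 𝒟.onCommonBlock i (e i h) x y) * (q * r)
  part-sameClass i x y h with A i h in a
  ... | false = trans (+-identityʳ _) (trans (#-true _) (trans (𝒟.points h) (sym (+-identityʳ _))))
  ... | true  = begin
    # (λ z → not (inImage i h x z) ∧ not (inImage i h y z)) + 1 * (q * r + q * r)
      ≡⟨ cong₂ _+_ (#-cong λ z → cong₂ (λ s t → not s ∧ not t) (inImage≡∈image a x z) (inImage≡∈image a y z))
                   (*-identityˡ (q * r + q * r)) ⟩
    # (λ z → not (I (D h) z (image i h a x)) ∧ not (I (D h) z (image i h a y))) + (q * r + q * r)
      ≡⟨ +-assoc _ (q * r) (q * r) ⟨
    # (λ z → not (I (D h) z (image i h a x)) ∧ not (I (D h) z (image i h a y))) + q * r + q * r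
      ≡⟨ 𝒟.#-outside-both h (image i h a x) (image i h a y) ⟩
    q * (q * r) + meet (D h) (image i h a x) (image i h a y)
      ≡⟨ cong (q * (q * r) +_) (meet-images a x y) ⟩
    q * (q * r) + 𝟙 (I (D i) y (blockFacing a x)) * (q * r)
      ≡⟨ cong (λ b → q * (q * r) + 𝟙 b * (q * r)) (𝒟.anyFin-blockOf i (range i h a) x (I (D i) y)) ⟨
    q * (q * r) + 𝟙 (𝒟.onCommonBlock i (e i h) x y) * (q * r)
      ∎
    where open ≡-Reasoning

  part-diffClass : ∀ {i j} x y h → i ≢ j →
    # (λ z → adj (i , x) (h , z) ∧ adj (j , y) (h , z)) + 𝟙 (A i h) * (q * r) + 𝟙 (A j h) * (q * r)
      ≡ q * (q * r) + 𝟙 (A i h ∧ A j h) * r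
  part-diffClass {i} {j} x y h i≢j with A i h in a | A j h in b
  ... | false | false =
    trans (+-identityʳ _) (trans (+-identityʳ _) (trans (#-true _) (trans (𝒟.points h) (sym (+-identityʳ _)))))
  ... | true  | false = begin
    # (λ z → not (inImage i h x z) ∧ true) + 1 * (q * r) + 0
      ≡⟨ +-identityʳ _ ⟩
    # (λ z → not (inImage i h x z) ∧ true) + 1 * (q * r)
      ≡⟨ cong₂ _+_ (#-cong λ z → trans (∧-identityʳ _) (cong not (inImage≡∈image a x z))) (*-identityˡ (q * r)) ⟩
    # (λ z → not (I (D h) z (image i h a x))) + q * r
      ≡⟨ 𝒟.#-outside h (image i h a x) ⟩
    q * (q * r)
      ≡⟨ +-identityʳ _ ⟨
    q * (q * r) + 0
      ∎
    where open ≡-Reasoning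
  ... | false | true  = begin
    # (λ z → not (inImage j h y z)) + 0 + 1 * (q * r)
      ≡⟨ cong₂ _+_ (trans (+-identityʳ _) (#-cong λ z → cong not (inImage≡∈image b y z))) (*-identityˡ (q * r)) ⟩
    # (λ z → not (I (D h) z (image j h b y))) + q * r
      ≡⟨ 𝒟.#-outside h (image j h b y) ⟩
    q * (q * r)
      ≡⟨ +-identityʳ _ ⟨
    q * (q * r) + 0
      ∎
    where open ≡-Reasoning
  ... | true  | true  = begin
    # (λ z → not (inImage i h x z) ∧ not (inImage j h y z)) + 1 * (q * r) + 1 * (q * r)
      ≡⟨ cong₂ (λ s t → s + t + t)
               (#-cong λ z → cong₂ (λ s t → not s ∧ not t) (inImage≡∈image a x z) (inImage≡∈image b y z))
               (*-identityˡ (q * r)) ⟩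
    # (λ z → not (I (D h) z (image i h a x)) ∧ not (I (D h) z (image j h b y))) + q * r + q * r
      ≡⟨ 𝒟.#-outside-both h (image i h a x) (image j h b y) ⟩
    q * (q * r) + meet (D h) (image i h a x) (image j h b y)
      ≡⟨ cong (q * (q * r) +_) (𝒟.nonparallel⇒meet≡r h images-nonparallel) ⟩
    q * (q * r) + r
      ≡⟨ cong (q * (q * r) +_) (*-identityˡ r) ⟨
    q * (q * r) + 1 * r
      ∎
    where
    open ≡-Reasoning
    images-nonparallel : cls (P h) (image i h a x) ≢ cls (P h) (image j h b y)
    images-nonparallel same-class = i≢j (injective h i j (trans (A-sym h i) a) (trans (A-sym h j) b)
      (trans (sym (cls-image a x)) (trans same-class (cls-image b y))))

  #-adjPC : ∀ v → countB (adjPC v) vertices ≡ ∑[ j < m ] # (λ y → adj v (j , y))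
  #-adjPC v = trans (count-vertices (adjPC v)) (sum-cong-≗ (λ j → #-cong (λ y → adjPC≡adj v (j , y))))

  #-adjPC-common : ∀ v w →
    countB (λ z → adjPC v z ∧ adjPC z w) vertices ≡ ∑[ h < m ] # (λ z → adj v (h , z) ∧ adj w (h , z))
  #-adjPC-common v w = trans (count-vertices _) (sum-cong-≗ λ h → #-cong λ z →
    cong₂ _∧_ (adjPC≡adj v (h , z)) (trans (adjPC≡adj (h , z) w) (adj-sym (h , z) w)))

  order : length vertices ≡ m * (q * (q * r))
  order = begin
    length vertices                                ≡⟨ length≡countB-true vertices ⟩
    countB (λ _ → true) vertices                   ≡⟨ count-vertices (λ _ → true) ⟩
    ∑[ i < m ] # (λ (_ : Fin (nP (D i))) → true)   ≡⟨ sum-cong-≗ (λ i → trans (#-true _) (𝒟.points i)) ⟩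
    ∑[ i < m ] (q * (q * r))                       ≡⟨ sum-const m (q * (q * r)) ⟩
    m * (q * (q * r))                              ∎
    where open ≡-Reasoning

  class-size : ∀ c → countB (λ v → ⌊ proj₁ v ≟ᶠ c ⌋) vertices ≡ q * (q * r)
  class-size c = begin
    countB (λ v → ⌊ proj₁ v ≟ᶠ c ⌋) vertices
      ≡⟨ count-vertices _ ⟩
    ∑[ i < m ] # (λ (_ : Fin (nP (D i))) → ⌊ i ≟ᶠ c ⌋)
      ≡⟨ sum-cong-≗ (λ i → #-const _ ⌊ i ≟ᶠ c ⌋) ⟩
    ∑[ i < m ] (𝟙 ⌊ i ≟ᶠ c ⌋ * nP (D i))
      ≡⟨ sum-single _ c (λ i i≢c → cong (_* nP (D i)) (𝟙-≟-≢ i≢c)) ⟩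
    𝟙 ⌊ c ≟ᶠ c ⌋ * nP (D c)
      ≡⟨ cong (_* nP (D c)) (𝟙-≟-≡ {x = c} refl) ⟩
    1 * nP (D c)
      ≡⟨ *-identityˡ (nP (D c)) ⟩
    nP (D c)
      ≡⟨ 𝒟.points c ⟩
    q * (q * r)
      ∎
    where open ≡-Reasoning

  degree-count : ∀ i x → countB (adjPC (i , x)) vertices + κ * (q * r) ≡ m * (q * (q * r))
  degree-count i x = begin
    countB (adjPC (i , x)) vertices + κ * (q * r)
      ≡⟨ cong₂ (λ s t → s + t * (q * r)) (#-adjPC (i , x)) (sym (#-row i)) ⟩
    ∑[ j < m ] # (λ y → adj (i , x) (j , y)) + # (A i) * (q * r)
      ≡⟨ sum-+-#* (λ j → # (λ y → adj (i , x) (j , y))) (A i) (q * r) ⟨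
    ∑[ j < m ] (# (λ y → adj (i , x) (j , y)) + 𝟙 (A i j) * (q * r))
      ≡⟨ sum-cong-≗ (part-degree i x) ⟩
    ∑[ j < m ] (q * (q * r))
      ≡⟨ sum-const m (q * (q * r)) ⟩
    m * (q * (q * r))
      ∎
    where open ≡-Reasoning

  sameClass-count : ∀ i {x y} → x ≢ y →
    countB (λ z → adjPC (i , x) z ∧ adjPC z (i , y)) vertices + κ * (q * r + q * r)
      ≡ m * (q * (q * r)) + AffineDesign.λA (D i) * (q * r)
  sameClass-count i {x} {y} x≢y = begin
    countB (λ z → adjPC (i , x) z ∧ adjPC z (i , y)) vertices + κ * (q * r + q * r)
      ≡⟨ cong₂ (λ s t → s + t * (q * r + q * r)) (#-adjPC-common (i , x) (i , y)) (sym (#-row i)) ⟩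
    ∑[ h < m ] common h + # (A i) * (q * r + q * r)
      ≡⟨ sum-+-#* common (A i) (q * r + q * r) ⟨
    ∑[ h < m ] (common h + 𝟙 (A i h) * (q * r + q * r))
      ≡⟨ sum-cong-≗ (part-sameClass i x y) ⟩
    ∑[ h < m ] (q * (q * r) + 𝟙 (A i h ∧ 𝒟.onCommonBlock i (e i h) x y) * (q * r))
      ≡⟨ sum-+-#* (λ _ → q * (q * r)) (λ h → A i h ∧ 𝒟.onCommonBlock i (e i h) x y) (q * r) ⟩
    ∑[ h < m ] (q * (q * r)) + # (λ h → A i h ∧ 𝒟.onCommonBlock i (e i h) x y) * (q * r)
      ≡⟨ cong₂ (λ s t → s + t * (q * r)) (sum-const m (q * (q * r)))
               (#-row-labels i (λ ℓ → 𝒟.onCommonBlock i ℓ x y)) ⟩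
    m * (q * (q * r)) + # (λ (c : Fin κ) → 𝒟.onCommonBlock i (suc (toℕ c)) x y) * (q * r)
      ≡⟨ cong (λ t → m * (q * (q * r)) + t * (q * r)) (𝒟.#-blocks-through-both i x y) ⟨
    m * (q * (q * r)) + # (λ B → I (D i) x B ∧ I (D i) y B) * (q * r)
      ≡⟨ cong (λ t → m * (q * (q * r)) + t * (q * r)) (AffineDesign.balanced (D i) x y x≢y) ⟩
    m * (q * (q * r)) + AffineDesign.λA (D i) * (q * r)
      ∎
    where
    open ≡-Reasoning
    common : Fin m → ℕ
    common h = # (λ z → adj (i , x) (h , z) ∧ adj (i , y) (h , z))

  diffClass-count : ∀ {i j} x y → i ≢ j →
    countB (λ z → adjPC (i , x) z ∧ adjPC z (j , y)) vertices + κ * (q * r) + κ * (q * r)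
      ≡ m * (q * (q * r)) + lam * r
  diffClass-count {i} {j} x y i≢j = begin
    countB (λ z → adjPC (i , x) z ∧ adjPC z (j , y)) vertices + κ * (q * r) + κ * (q * r)
      ≡⟨ cong₂ (λ s t → s + t * (q * r) + κ * (q * r)) (#-adjPC-common (i , x) (j , y)) (sym (#-row i)) ⟩
    ∑[ h < m ] common h + # (A i) * (q * r) + κ * (q * r)
      ≡⟨ cong₂ (λ s t → s + t * (q * r)) (sum-+-#* common (A i) (q * r)) (#-row j) ⟨
    ∑[ h < m ] (common h + 𝟙 (A i h) * (q * r)) + # (A j) * (q * r)
      ≡⟨ sum-+-#* (λ h → common h + 𝟙 (A i h) * (q * r)) (A j) (q * r) ⟨
    ∑[ h < m ] (common h + 𝟙 (A i h) * (q * r) + 𝟙 (A j h) * (q * r))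
      ≡⟨ sum-cong-≗ (λ h → part-diffClass x y h i≢j) ⟩
    ∑[ h < m ] (q * (q * r) + 𝟙 (A i h ∧ A j h) * r)
      ≡⟨ sum-+-#* (λ _ → q * (q * r)) (λ h → A i h ∧ A j h) r ⟩
    ∑[ h < m ] (q * (q * r)) + # (λ h → A i h ∧ A j h) * r
      ≡⟨ cong₂ (λ s t → s + t * r) (sum-const m (q * (q * r))) (IsSymDesign.balanced A-design i j i≢j) ⟩
    m * (q * (q * r)) + lam * r
      ∎
    where
    open ≡-Reasoning
    common : Fin m → ℕ
    common h = # (λ z → adj (i , x) (h , z) ∧ adj (j , y) (h , z))

2≤classes : ∀ {p r κ} → suc (κ * suc p) ≡ suc (suc p) * (suc (suc p) * r) → 2 ≤ κ
2≤classes {p} {r} {zero}     hκ = contradiction (m*n≡1⇒m≡1 (suc (suc p)) (suc (suc p) * r) (sym hκ)) λ ()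
2≤classes {p} {r} {suc zero} hκ = contradiction (m*n≡1⇒m≡1 (suc (suc p)) r (sym 1≡qr)) λ ()
  where
  ring : ∀ p → suc (suc p) * 1 ≡ suc (1 * suc p)
  ring = solve-∀
  1≡qr : 1 ≡ suc (suc p) * r
  1≡qr = *-cancelˡ-≡ 1 (suc (suc p) * r) (suc (suc p)) (trans (ring p) hκ)
2≤classes {κ = suc (suc κ)} _ = s≤s (s≤s z≤n)

κ≡1+qλ : ∀ {p X κ L} → suc (κ * suc p) ≡ suc (suc p) * X → suc (L * suc p) ≡ X → κ ≡ suc (suc (suc p) * L)
κ≡1+qλ {p} {_} {κ} {L} hκ refl =
  *-cancelʳ-≡ κ (suc (suc (suc p) * L)) (suc p) (suc-injective (trans hκ (ring p L)))
  where
  ring : ∀ p L → suc (suc p) * suc (L * suc p) ≡ suc (suc (suc (suc p) * L) * suc p)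
  ring = solve-∀

degree-formula : ∀ {p r κ m C} → let q = suc (suc p) in
  suc (κ * suc p) ≡ q * (q * r) → κ ≤ m → C + κ * (q * r) ≡ m * (q * (q * r)) →
  C ≡ q * r * (q * (q * r) ∸ 1) + q * (q * r) * (m ∸ κ)
degree-formula {p} {r} {κ} {m} {C} hκ κ≤m count = +-cancelʳ-≡ (κ * X) C _ (begin
  C + κ * X                                 ≡⟨ count ⟩
  m * n                                     ≡⟨ cong (_* n) (m+[n∸m]≡n κ≤m) ⟨
  (κ + (m ∸ κ)) * n                         ≡⟨ ring p r κ (m ∸ κ) ⟩
  X * (κ * suc p) + n * (m ∸ κ) + κ * X     ≡⟨ cong (λ t → X * (t ∸ 1) + n * (m ∸ κ) + κ * X) hκ ⟩
  X * (n ∸ 1) + n * (m ∸ κ) + κ * X         ∎)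
  where
  open ≡-Reasoning
  X = suc (suc p) * r
  n = suc (suc p) * X
  ring : ∀ p r κ u → let q = suc (suc p) in
         (κ + u) * (q * (q * r)) ≡ q * r * (κ * suc p) + q * (q * r) * u + κ * (q * r)
  ring = solve-∀

λ₁-formula : ∀ {p X L κ m C} → let q = suc (suc p) in
  suc (L * suc p) ≡ X → κ ≡ suc (q * L) → κ ≤ m → C + κ * (X + X) ≡ m * (q * X) + L * X →
  C ≡ X * (q * X ∸ X ∸ 1) + q * X * (m ∸ κ)
λ₁-formula {p} {_} {L} {_} {m} {C} refl refl κ≤m count = +-cancelʳ-≡ (κ * (X + X)) C _ (begin
  C + κ * (X + X)                                       ≡⟨ count ⟩
  m * n + L * X                                         ≡⟨ cong (λ t → t * n + L * X) (m+[n∸m]≡n κ≤m) ⟨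
  (κ + (m ∸ κ)) * n + L * X                             ≡⟨ ring p L (m ∸ κ) ⟩
  X * (L * suc p + p * X) + n * (m ∸ κ) + κ * (X + X)   ≡⟨ cong (λ t → X * (t ∸ 1) + n * (m ∸ κ) + κ * (X + X))
                                                                (m+n∸m≡n X (suc p * X)) ⟨
  X * (n ∸ X ∸ 1) + n * (m ∸ κ) + κ * (X + X)           ∎)
  where
  open ≡-Reasoning
  X = suc (L * suc p)
  n = suc (suc p) * X
  κ = suc (suc (suc p) * L)
  ring : ∀ p L u → let q = suc (suc p); X = suc (L * suc p); κ = suc (q * L) in
         (κ + u) * (q * X) + L * X ≡ X * (L * suc p + p * X) + q * X * u + κ * (X + X)
  ring = solve-∀

λ₂-formula : ∀ {p r κ m lam C} → let q = suc (suc p) in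
  lam ≤ κ → 2 * κ ≤ m + lam → C + κ * (q * r) + κ * (q * r) ≡ m * (q * (q * r)) + lam * r →
  C ≡ r * (suc p * suc p) * lam + 2 * (q * (q * r) ∸ q * r) * (κ ∸ lam) + q * (q * r) * ((m + lam) ∸ 2 * κ)
λ₂-formula {p} {r} {κ} {m} {lam} {C} lam≤κ 2κ≤m+lam count = +-cancelʳ-≡ (2 * κ * X + lam * n) C _ (begin
  C + (2 * κ * X + lam * n)                       ≡⟨ regroup C κ X lam n ⟩
  C + κ * X + κ * X + lam * n                     ≡⟨ cong (_+ lam * n) count ⟩
  m * n + lam * r + lam * n                       ≡⟨ regroup′ m n lam r ⟩
  (m + lam) * n + lam * r                         ≡⟨ cong (λ t → t * n + lam * r) (m+[n∸m]≡n 2κ≤m+lam) ⟨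
  (2 * κ + w) * n + lam * r                       ≡⟨ cong (λ t → (2 * t + w) * n + lam * r) (m+[n∸m]≡n lam≤κ) ⟨
  (2 * (lam + v) + w) * n + lam * r               ≡⟨ ring p r lam v w ⟩
  T (suc p * X) + (2 * (lam + v) * X + lam * n)   ≡⟨ cong₂ (λ s t → T s + (2 * t * X + lam * n))
                                                           (m+n∸m≡n X (suc p * X)) (sym (m+[n∸m]≡n lam≤κ)) ⟨
  T (n ∸ X) + (2 * κ * X + lam * n)               ∎)
  where
  open ≡-Reasoning
  X = suc (suc p) * r
  n = suc (suc p) * X
  v = κ ∸ lam
  w = (m + lam) ∸ 2 * κ
  T : ℕ → ℕ
  T n∸X = r * (suc p * suc p) * lam + 2 * n∸X * v + n * w
  regroup : ∀ C κ X lam n → C + (2 * κ * X + lam * n) ≡ C + κ * X + κ * X + lam * n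
  regroup = solve-∀
  regroup′ : ∀ m n lam r → m * n + lam * r + lam * n ≡ (m + lam) * n + lam * r
  regroup′ = solve-∀
  ring : ∀ p r lam v w → let q = suc (suc p); X = q * r; n = q * X in
         (2 * (lam + v) + w) * n + lam * r
           ≡ r * (suc p * suc p) * lam + 2 * (suc p * X) * v + n * w + (2 * (lam + v) * X + lam * n)
  ring = solve-∀

theorem2 : (q d : ℕ) → 2 ≤ q → 2 ≤ d →
    (κ : ℕ) → κ * (q ∸ 1) ≡ q ^ d ∸ 1 →
    (m lam : ℕ) (A : Fin m → Fin m → Bool) →
    IsSymDesign m κ lam A → (∀ i j → A i j ≡ A j i) →
    (e : Fin m → Fin m → ℕ) → (∀ i j → e i j ≡ e j i) → IsLabelling m κ A e →
    (D : Fin m → AffineDesign q (q ^ (d ∸ 2))) →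
    (P : (i : Fin m) → ParallelEnum (D i) κ) →
    (σ : (i j : Fin m) → Fin (AffineDesign.nB (D i)) → Fin (AffineDesign.nB (D j))) →
    Construction.SigmaOK A e D P σ →
    (∀ i → Construction.blockZero A e D P σ i i ≡ false) →
    IsDDG (Construction.vertices A e D P σ) (Construction.adjPC A e D P σ)
      (q ^ d * m)
      (q ^ (d ∸ 1) * (q ^ d ∸ 1) + q ^ d * (m ∸ κ))
      (q ^ (d ∸ 1) * (q ^ d ∸ q ^ (d ∸ 1) ∸ 1) + q ^ d * (m ∸ κ))
      (q ^ (d ∸ 2) * ((q ∸ 1) * (q ∸ 1)) * lam + 2 * (q ^ d ∸ q ^ (d ∸ 1)) * (κ ∸ lam)
        + q ^ d * ((m + lam) ∸ 2 * κ))
      m (q ^ d)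
theorem2 q@(suc (suc p)) (suc (suc d)) 2≤q@(s≤s (s≤s _)) (s≤s (s≤s _)) κ hκ m lam A A-design A-sym e _ lab
         D P σ σ-ok diagonal = record
  { order     = trans order (*-comm m (q * (q * r)))
  ; symm      = λ v w → trans (adjPC≡adj v w) (trans (adj-sym v w) (sym (adjPC≡adj w v)))
  ; irrefl    = λ v → trans (adjPC≡adj v v) (adj-irrefl v)
  ; regular   = λ { (i , x) → degree-formula {p} {r} hκ′ (κ≤m i) (degree-count i x) }
  ; class     = proj₁
  ; classSize = class-size
  ; sameClass = λ { (i , x) (_ , y) v≢w refl →
      λ₁-formula {p} {L = λA i} (λA-rel i x) (κ≡1+qλ {p} {L = λA i} hκ′ (λA-rel i x)) (κ≤m i)
                 (sameClass-count i (v≢w ∘ cong (i ,_))) }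
  ; diffClass = λ { (i , x) (j , y) i≢j →
      λ₂-formula {p} {r} (lam≤κ i≢j) (2κ≤m+lam i≢j) (diffClass-count x y i≢j) }
  }
  where
  r = q ^ d
  hκ′ : suc (κ * suc p) ≡ q * (q * r)
  hκ′ = trans (cong suc hκ) (m+[n∸m]≡n (m^n>0 q (2 + d)))
  open SymmetricDesignProperties A-design A-sym
  open PCGraph A-design A-sym lab σ-ok diagonal 2≤q (m^n>0 q d) (2≤classes {r = r} hκ′)
  λA : Fin m → ℕ
  λA i = AffineDesign.λA (D i)
  λA-rel : ∀ i → Fin (AffineDesign.nP (D i)) → suc (λA i * suc p) ≡ q * r
  λA-rel i x = 𝒟.λA-relation i x hκ′
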